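{- Let $G$ be a finite simple connected graph with no induced $P_5$ and no induced $K_{2,3}$, and let $C=v_1v_2v_3v_4v_5v_1$ be an induced 5-cycle of $G$. If $G$ has no clique cut set, then $N^3(C)=\emptyset$, and for each component $B$ of $G[N^2(C)]$, $\alpha(B)\le 2$, and moreover $N(B)\cap N(C)\subseteq N_{\{1,2,3,4,5\}}(C)$ whenever $\omega(B)=\omega(G)$.
   Context: For $X\subseteq V(G)$, $N^i(X)$ is the set of vertices not in $X$ at distance exactly $i$ from $X$, and $N(X)=N^1(X)$. $N_{\{1,2,3,4,5\}}(C)$ is the set of vertices outside $C$ adjacent to all five vertices of $C$. A clique cut set is a clique $S$ with $G-S$ disconnected. $\alpha$ is the independence number, $\omega$ the clique number. -}

module Defs where

open import Data.Nat using (ℕ; zero; suc; _≤_; _≡ᵇ_; _<ᵇ_)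
open import Data.Bool using (Bool; true; false; _∨_; _∧_; _xor_)
open import Data.Fin using (Fin; toℕ)
open import Data.List using (List; length)
open import Data.List.Relation.Unary.All using (All)
open import Data.List.Relation.Unary.AllPairs using (AllPairs)
open import Data.Product using (Σ; ∃; _×_; _,_)
open import Data.Unit using (⊤)
open import Relation.Binary.PropositionalEquality using (_≡_; _≢_)
open import Relation.Nullary using (¬_)
open import Function.Definitions using (Injective)

record Graph : Set where
  field
    n      : ℕ
    adj    : Fin n → Fin n → Bool
    sym    : ∀ u v → adj u v ≡ adj v u
    irrefl : ∀ u → adj u u ≡ false

open Graph public

V : Graph → Set
V G = Fin (n G)

Adj : (G : Graph) → V G → V G → Set
Adj G u v = adj G u v ≡ true

VSet : Graph → Set₁
VSet G = V G → Set

data WalkIn (G : Graph) (P : VSet G) : V G → V G → ℕ → Set where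
  here : ∀ {u} → P u → WalkIn G P u u 0
  step : ∀ {u w v k} → P u → Adj G u w → WalkIn G P w v k → WalkIn G P u v (suc k)

Everything : (G : Graph) → VSet G
Everything G _ = ⊤

Walk : (G : Graph) → V G → V G → ℕ → Set
Walk G = WalkIn G (Everything G)

Connected : Graph → Set
Connected G = ∀ u v → ∃ λ k → Walk G u v k

HasInduced : (m : ℕ) → (Fin m → Fin m → Bool) → Graph → Set
HasInduced m h G =
  Σ (Fin m → V G) λ f → Injective _≡_ _≡_ f × (∀ i j → adj G (f i) (f j) ≡ h i j)

P5adj : Fin 5 → Fin 5 → Bool
P5adj i j = (suc (toℕ i) ≡ᵇ toℕ j) ∨ (suc (toℕ j) ≡ᵇ toℕ i)

-- K_{2,3}: parts {0,1} and {2,3,4}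
K23adj : Fin 5 → Fin 5 → Bool
K23adj i j = (toℕ i <ᵇ 2) xor (toℕ j <ᵇ 2)

C5adj : Fin 5 → Fin 5 → Bool
C5adj i j = P5adj i j ∨ ((toℕ i ≡ᵇ 0) ∧ (toℕ j ≡ᵇ 4)) ∨ ((toℕ i ≡ᵇ 4) ∧ (toℕ j ≡ᵇ 0))

DistFrom : (G : Graph) → VSet G → V G → ℕ → Set
DistFrom G X u i =
  (∃ λ x → X x × Walk G x u i) × (∀ j x → X x → Walk G x u j → i ≤ j)

Nbhd : (G : Graph) → ℕ → VSet G → VSet G
Nbhd G i X u = ¬ X u × DistFrom G X u i

N1 : (G : Graph) → VSet G → VSet G
N1 G X = Nbhd G 1 X

IsClique : (G : Graph) → VSet G → Set
IsClique G S = ∀ x y → S x → S y → x ≢ y → Adj G x y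

Complement : (G : Graph) → VSet G → VSet G
Complement G S u = ¬ S u

DisconnectedWithout : (G : Graph) → VSet G → Set
DisconnectedWithout G S =
  ∃ λ u → ∃ λ v → ¬ S u × ¬ S v × ¬ (∃ λ k → WalkIn G (Complement G S) u v k)

HasCliqueCutSet : Graph → Set₁
HasCliqueCutSet G = Σ (VSet G) λ S → IsClique G S × DisconnectedWithout G S

-- c is an induced 5-cycle v1 v2 v3 v4 v5 (v_{i+1} = c i).
IsInducedC5 : (G : Graph) → (Fin 5 → V G) → Set
IsInducedC5 G c = Injective _≡_ _≡_ c × (∀ i j → adj G (c i) (c j) ≡ C5adj i j)

VertexSetOf : (G : Graph) → (Fin 5 → V G) → VSet G
VertexSetOf G c u = ∃ λ i → c i ≡ u

ComponentOf : (G : Graph) → VSet G → V G → VSet G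
ComponentOf G X b u = ∃ λ k → WalkIn G X b u k

CliqueList : (G : Graph) → VSet G → List (V G) → Set
CliqueList G X L = All X L × AllPairs (λ x y → x ≢ y × Adj G x y) L

IndepList : (G : Graph) → VSet G → List (V G) → Set
IndepList G X L = All X L × AllPairs (λ x y → x ≢ y × ¬ Adj G x y) L

AlphaLe : (G : Graph) → VSet G → ℕ → Set
AlphaLe G X k = ∀ L → IndepList G X L → length L ≤ k

IsCliqueNumber : (G : Graph) → VSet G → ℕ → Set
IsCliqueNumber G X k =
  (∃ λ L → CliqueList G X L × length L ≡ k) × (∀ L → CliqueList G X L → length L ≤ k)

SameCliqueNumber : (G : Graph) → VSet G → Set
SameCliqueNumber G X = ∃ λ k → IsCliqueNumber G X k × IsCliqueNumber G (Everything G) k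

NAll : (G : Graph) → (Fin 5 → V G) → VSet G
NAll G c u = ¬ VertexSetOf G c u × (∀ i → Adj G u (c i))

Inter : (G : Graph) → VSet G → VSet G → VSet G
Inter G X Y u = X u × Y u

Subset : (G : Graph) → VSet G → VSet G → Set
Subset G X Y = ∀ u → X u → Y u

{-# OPTIONS --safe #-}
-- Call a vertex attached if it lies in N(C), and distant if it lies outside C ∪ N(C).
-- Without induced P5, an attached vertex seeing c_i but not c_{i+1} is adjacent to every vertex of
-- any walk of distant vertices starting in its neighbourhood, so it is complete to C or dominates
-- the distant components it touches. Without induced K23, a vertex complete to C and a nonadjacent
-- attached vertex share no distant neighbour. Together these make the attached neighbours of a set
-- D of distant vertices a clique, which separates D from C, when D is the distant component of a
-- vertex of N³(C), or a component of G[N²(C)] containing three independent vertices. For ω: an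
-- attached neighbour of B that is not complete to C dominates B, so it would extend a maximum
-- clique of B.
module Submission where

open import Defs
open import Data.Bool using (Bool; true; false)
open import Data.Bool.Properties using (¬-not) renaming (_≟_ to _≟ᵇ_)
open import Data.Empty using (⊥; ⊥-elim)
open import Data.Fin using (Fin; zero; suc; toℕ; _<_)
open import Data.Fin.Patterns using (0F; 1F; 2F; 3F; 4F)
open import Data.Fin.Properties using (_≟_; all?; any?; <-cmp)
open import Data.List using ([]; _∷_)
open import Data.List.Relation.Unary.All as All using (_∷_)
open import Data.List.Relation.Unary.AllPairs using (_∷_)
open import Data.Nat using (zero; suc; _+_; _≤_; s≤s; z≤n)
open import Data.Nat.GeneralisedArithmetic using (iterate)
open import Data.Nat.Properties using (n≮n; <⇒≱; n<1+n)
open import Data.Product using (∃; _×_; _,_; proj₁; proj₂)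
open import Data.Sum using (_⊎_; inj₁; inj₂; swap; [_,_]′)
open import Data.Unit using (tt)
open import Data.Vec using (Vec; []; _∷_; lookup; allFin; tabulate)
open import Data.Vec.Relation.Unary.All.Properties using (tabulate⁻)
open import Data.Vec.Relation.Unary.AllPairs as VecAllPairs using ([]; _∷_)
open import Data.Vec.Relation.Unary.All using ([]; _∷_)
open import Data.Vec.Relation.Unary.Unique.Propositional using (Unique)
open import Data.Vec.Relation.Unary.Unique.Propositional.Properties using (lookup-injective)
open import Relation.Binary.Core using (Rel)
open import Relation.Binary.Definitions using (tri<; tri≈; tri>)
open import Relation.Binary.PropositionalEquality as ≡ using (_≡_; _≢_; ≢-sym)
open import Relation.Nullary using (¬_; Dec; yes; no)
open import Relation.Nullary.Decidable using (from-yes; ¬?; _×-dec_)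

next : Fin 5 → Fin 5
next 0F = 1F
next 1F = 2F
next 2F = 3F
next 3F = 4F
next 4F = 0F

next-orbit : ∀ i j → ∃ λ (m : Fin 5) → iterate next i (toℕ m) ≡ j
next-orbit = from-yes (all? λ (i : Fin 5) → all? λ j → any? λ (m : Fin 5) → iterate next i (toℕ m) ≟ j)

next⁵ : ∀ i → next (next (next (next (next i)))) ≡ i
next⁵ = from-yes (all? λ i → next (next (next (next (next i)))) ≟ i)

next²-≢ : ∀ i → i ≢ next (next i)
next²-≢ = from-yes (all? λ i → ¬? (i ≟ next (next i)))

next-invariant : {P : Fin 5 → Set} → (∀ {i} → P i → P (next i)) → ∀ {i} → P i → ∀ j → P j
next-invariant {P} P-next {i} Pi j with next-orbit i j
... | m , ≡.refl = along (toℕ m) Pi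
  where
  along : ∀ k {l} → P l → P (iterate next l k)
  along zero Pl = Pl
  along (suc k) Pl = along k (P-next Pl)

somewhere⇒everywhere-or-switch : (g : Fin 5 → Bool) → ∃ (λ i → g i ≡ true) →
  (∀ j → g j ≡ true) ⊎ ∃ λ i → g i ≡ true × g (next i) ≡ false
somewhere⇒everywhere-or-switch g (i , gi) with any? (λ k → (g k ≟ᵇ true) ×-dec (g (next k) ≟ᵇ false))
... | yes switch = inj₂ switch
... | no no-switch = inj₁ (next-invariant (λ {k} gk → ¬-not λ gk′ → no-switch (k , gk , gk′)) gi)

C5-next : ∀ i → C5adj i (next i) ≡ true
C5-next = from-yes (all? λ i → C5adj i (next i) ≟ᵇ true)

C5-next² : ∀ i → C5adj i (next (next i)) ≡ false
C5-next² = from-yes (all? λ i → C5adj i (next (next i)) ≟ᵇ false)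

C5-next³ : ∀ i → C5adj i (next (next (next i))) ≡ false
C5-next³ = from-yes (all? λ i → C5adj i (next (next (next i))) ≟ᵇ false)

P5-sym : ∀ i j → P5adj i j ≡ P5adj j i
P5-sym = from-yes (all? λ i → all? λ j → P5adj i j ≟ᵇ P5adj j i)

P5-irrefl : ∀ i → P5adj i i ≡ false
P5-irrefl = from-yes (all? λ i → P5adj i i ≟ᵇ false)

K23-sym : ∀ i j → K23adj i j ≡ K23adj j i
K23-sym = from-yes (all? λ i → all? λ j → K23adj i j ≟ᵇ K23adj j i)

K23-irrefl : ∀ i → K23adj i i ≡ false
K23-irrefl = from-yes (all? λ i → K23adj i i ≟ᵇ false)

allPairs-tabulate⁻ : ∀ {a ℓ} {A : Set a} {R : Rel A ℓ} {m} {f : Fin m → A} →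
  VecAllPairs.AllPairs R (tabulate f) → ∀ {i j} → i < j → R (f i) (f j)
allPairs-tabulate⁻ (px ∷ _) {zero} {suc j} _ = tabulate⁻ px j
allPairs-tabulate⁻ (_ ∷ pxs) {suc i} {suc j} (s≤s i<j) = allPairs-tabulate⁻ pxs i<j

module GraphLemmas (G : Graph) where

  infix 4 _~_ _≁_
  _~_ _≁_ : V G → V G → Set
  x ~ y = adj G x y ≡ true
  x ≁ y = adj G x y ≡ false

  adj-sym : ∀ {x y b} → adj G x y ≡ b → adj G y x ≡ b
  adj-sym {x} {y} xy≡b = ≡.trans (sym G y x) xy≡b

  adjacent-or-not : ∀ x y → x ~ y ⊎ x ≁ y
  adjacent-or-not x y with adj G x y
  ... | true = inj₁ ≡.refl
  ... | false = inj₂ ≡.refl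

  ~⇒¬≁ : ∀ {x y} → x ~ y → ¬ x ≁ y
  ~⇒¬≁ x~y x≁y with () ← ≡.trans (≡.sym x~y) x≁y

  adjacent-unless : ∀ {x y} → ¬ x ≁ y → x ~ y
  adjacent-unless {x} {y} ¬x≁y with adjacent-or-not x y
  ... | inj₁ x~y = x~y
  ... | inj₂ x≁y = ⊥-elim (¬x≁y x≁y)

  ~⇒≢ : ∀ {x y} → x ~ y → x ≢ y
  ~⇒≢ {x} x~y ≡.refl = ~⇒¬≁ x~y (irrefl G x)

  separated-by : ∀ {x y z} → x ≁ z → y ~ z → x ≢ y
  separated-by x≁z y~z ≡.refl = ~⇒¬≁ y~z x≁z

  Independent : V G → V G → Set
  Independent x y = x ≢ y × x ≁ y

  ¬adjacent⇒independent : ∀ {x y} → x ≢ y × ¬ Adj G x y → Independent x y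
  ¬adjacent⇒independent (x≢y , ¬x~y) = x≢y , ¬-not ¬x~y

  independent-sym : ∀ {x y} → Independent x y → Independent y x
  independent-sym (x≢y , x≁y) = ≢-sym x≢y , adj-sym x≁y

  induced-copy : ∀ {m} (h : Fin m → Fin m → Bool) → (∀ i j → h i j ≡ h j i) → (∀ i → h i i ≡ false) →
    (vs : Vec (V G) m) → Unique vs →
    VecAllPairs.AllPairs (λ i j → adj G (lookup vs i) (lookup vs j) ≡ h i j) (allFin m) →
    HasInduced m h G
  induced-copy h h-sym h-irrefl vs distinct upper =
    lookup vs , (λ {i} {j} → lookup-injective distinct i j) , adjacency
    where
    adjacency : ∀ i j → adj G (lookup vs i) (lookup vs j) ≡ h i j
    adjacency i j with <-cmp i j
    ... | tri< i<j _ _ = allPairs-tabulate⁻ upper i<j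
    ... | tri≈ _ ≡.refl _ = ≡.trans (irrefl G _) (≡.sym (h-irrefl i))
    ... | tri> _ _ j<i = ≡.trans (adj-sym (allPairs-tabulate⁻ upper j<i)) (h-sym j i)

  induced-P5 : ∀ {v₀ v₁ v₂ v₃ v₄} → v₀ ~ v₁ → v₁ ~ v₂ → v₂ ~ v₃ → v₃ ~ v₄ →
    v₀ ≁ v₂ → v₀ ≁ v₃ → v₀ ≁ v₄ → v₁ ≁ v₃ → v₁ ≁ v₄ → v₂ ≁ v₄ → HasInduced 5 P5adj G
  induced-P5 e₀₁ e₁₂ e₂₃ e₃₄ n₀₂ n₀₃ n₀₄ n₁₃ n₁₄ n₂₄ =
    induced-copy P5adj P5-sym P5-irrefl (_ ∷ _ ∷ _ ∷ _ ∷ _ ∷ [])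
      ( (~⇒≢ e₀₁ ∷ separated-by n₀₃ e₂₃ ∷ separated-by n₀₄ e₃₄ ∷ separated-by n₀₃ (adj-sym e₃₄) ∷ [])
      ∷ (~⇒≢ e₁₂ ∷ separated-by n₁₄ e₃₄ ∷ separated-by n₁₃ (adj-sym e₃₄) ∷ [])
      ∷ (~⇒≢ e₂₃ ∷ ≢-sym (separated-by (adj-sym n₁₄) (adj-sym e₁₂)) ∷ [])
      ∷ (~⇒≢ e₃₄ ∷ []) ∷ [] ∷ [])
      ( (e₀₁ ∷ n₀₂ ∷ n₀₃ ∷ n₀₄ ∷ []) ∷ (e₁₂ ∷ n₁₃ ∷ n₁₄ ∷ []) ∷ (e₂₃ ∷ n₂₄ ∷ []) ∷ (e₃₄ ∷ []) ∷ [] ∷ [])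

  induced-K23 : ∀ {s₀ s₁ t₀ t₁ t₂} → s₀ ~ t₀ → s₀ ~ t₁ → s₀ ~ t₂ → s₁ ~ t₀ → s₁ ~ t₁ → s₁ ~ t₂ →
    s₀ ≁ s₁ → t₀ ≁ t₁ → t₀ ≁ t₂ → t₁ ≁ t₂ → s₀ ≢ s₁ → t₀ ≢ t₁ → t₀ ≢ t₂ → t₁ ≢ t₂ →
    HasInduced 5 K23adj G
  induced-K23 a₀₀ a₀₁ a₀₂ a₁₀ a₁₁ a₁₂ s₀≁s₁ t₀≁t₁ t₀≁t₂ t₁≁t₂ s₀≢s₁ t₀≢t₁ t₀≢t₂ t₁≢t₂ =
    induced-copy K23adj K23-sym K23-irrefl (_ ∷ _ ∷ _ ∷ _ ∷ _ ∷ [])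
      ( (s₀≢s₁ ∷ ~⇒≢ a₀₀ ∷ ~⇒≢ a₀₁ ∷ ~⇒≢ a₀₂ ∷ [])
      ∷ (~⇒≢ a₁₀ ∷ ~⇒≢ a₁₁ ∷ ~⇒≢ a₁₂ ∷ []) ∷ (t₀≢t₁ ∷ t₀≢t₂ ∷ []) ∷ (t₁≢t₂ ∷ []) ∷ [] ∷ [])
      ( (s₀≁s₁ ∷ a₀₀ ∷ a₀₁ ∷ a₀₂ ∷ []) ∷ (a₁₀ ∷ a₁₁ ∷ a₁₂ ∷ [])
      ∷ (t₀≁t₁ ∷ t₀≁t₂ ∷ []) ∷ (t₁≁t₂ ∷ []) ∷ [] ∷ [])

  walk-head : ∀ {P u v k} → WalkIn G P u v k → P u
  walk-head (here Pu) = Pu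
  walk-head (step Pu _ _) = Pu

  walk-last : ∀ {P u v k} → WalkIn G P u v k → P v
  walk-last (here Pv) = Pv
  walk-last (step _ _ rest) = walk-last rest

  walk-snoc : ∀ {P u v w k} → WalkIn G P u v k → P w → v ~ w → WalkIn G P u w (suc k)
  walk-snoc (here Pu) Pw u~w = step Pu u~w (here Pw)
  walk-snoc (step Pu u~x rest) Pw v~w = step Pu u~x (walk-snoc rest Pw v~w)

  walk-reverse : ∀ {P u v k} → WalkIn G P u v k → WalkIn G P v u k
  walk-reverse (here Pu) = here Pu
  walk-reverse (step Pu u~x rest) = walk-snoc (walk-reverse rest) Pu (adj-sym u~x)

  walk-append : ∀ {P u v w k l} → WalkIn G P u v k → WalkIn G P v w l → WalkIn G P u w (k + l)
  walk-append (here _) walk = walk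
  walk-append (step Pu u~x rest) walk = step Pu u~x (walk-append rest walk)

  walk-map : ∀ {P Q : VSet G} {u v k} → (∀ {x} → P x → Q x) → WalkIn G P u v k → WalkIn G Q u v k
  walk-map P⊆Q (here Pu) = here (P⊆Q Pu)
  walk-map P⊆Q (step Pu u~x rest) = step (P⊆Q Pu) u~x (walk-map P⊆Q rest)

  component-member : ∀ {X b v} → ComponentOf G X b v → X v
  component-member (_ , walk) = walk-last walk

  component-extend : ∀ {X b v w} → ComponentOf G X b v → X w → v ~ w → ComponentOf G X b w
  component-extend (_ , walk) Xw v~w = _ , walk-snoc walk Xw v~w

  component-lift : ∀ {X b v t k} → ComponentOf G X b v → WalkIn G X v t k →
    WalkIn G (ComponentOf G X b) v t k
  component-lift Cv (here _) = here Cv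
  component-lift Cv (step _ v~w rest) =
    step Cv v~w (component-lift (component-extend Cv (walk-head rest) v~w) rest)

  component-walk : ∀ {X b v t} → ComponentOf G X b v → ComponentOf G X b t →
    ∃ λ k → WalkIn G (ComponentOf G X b) v t k
  component-walk Cv@(_ , b→v) (_ , b→t) = _ , component-lift Cv (walk-append (walk-reverse b→v) b→t)

  clique-cons : ∀ {X Y : VSet G} {L y} → CliqueList G X L → Y y → (∀ {z} → X z → Y z) →
    (∀ {z} → X z → y ≢ z × y ~ z) → CliqueList G Y (y ∷ L)
  clique-cons (XL , pairs) Yy X⊆Y y-joins = (Yy ∷ All.map X⊆Y XL) , (All.map y-joins XL ∷ pairs)

module InducedC5Lemmas (G : Graph) (c : Fin 5 → V G) (ic : IsInducedC5 G c) where

  open GraphLemmas G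

  InC : VSet G
  InC = VertexSetOf G c

  Distant Attached CompleteToC : VSet G
  Distant v = ¬ InC v × ∀ i → v ≁ c i
  Attached v = ¬ InC v × ∃ λ i → v ~ c i
  CompleteToC v = ∀ i → v ~ c i

  c-next : ∀ i → c i ~ c (next i)
  c-next i = ≡.trans (proj₂ ic i (next i)) (C5-next i)

  c-next² : ∀ i → c i ≁ c (next (next i))
  c-next² i = ≡.trans (proj₂ ic i (next (next i))) (C5-next² i)

  c-next³ : ∀ i → c i ≁ c (next (next (next i)))
  c-next³ i = ≡.trans (proj₂ ic i (next (next (next i)))) (C5-next³ i)

  c-next²-≢ : ∀ i → c i ≢ c (next (next i))
  c-next²-≢ i ci≡ci+2 = next²-≢ i (proj₁ ic ci≡ci+2)

  distant-≢ : ∀ {v} → Distant v → ∀ i → v ≢ c i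
  distant-≢ (v∉C , _) i v≡ci = v∉C (i , ≡.sym v≡ci)

  distant-nbr-∉C : ∀ {d w} → Distant d → d ~ w → ¬ InC w
  distant-nbr-∉C (_ , d≁C) d~w (i , ≡.refl) = ~⇒¬≁ d~w (d≁C i)

  complete⇒attached : ∀ {v} → CompleteToC v → Attached v
  complete⇒attached complete = (λ { (i , ≡.refl) → ~⇒≢ (complete i) ≡.refl }) , 0F , complete 0F

  attached? : ∀ v → Dec (Attached v)
  attached? v = ¬? (any? λ i → c i ≟ v) ×-dec any? λ i → adj G v (c i) ≟ᵇ true

  not-attached⇒distant : ∀ {v} → ¬ InC v → ¬ Attached v → Distant v
  not-attached⇒distant v∉C ¬attached = v∉C , λ i → ¬-not λ v~ci → ¬attached (v∉C , i , v~ci)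

  attached-complete-or-switch : ∀ {y} → Attached y →
    CompleteToC y ⊎ ∃ λ i → y ~ c i × y ≁ c (next i)
  attached-complete-or-switch {y} (_ , seen) = somewhere⇒everywhere-or-switch (λ i → adj G y (c i)) seen

  N1⇒attached : ∀ {y} → N1 G InC y → Attached y
  N1⇒attached (y∉C , (_ , (i , ≡.refl) , step _ ci~y (here _)) , _) = y∉C , i , adj-sym ci~y

  far⇒distant : ∀ {i v} → Nbhd G (suc (suc i)) InC v → Distant v
  far⇒distant (v∉C , _ , shortest) = v∉C , λ j → ¬-not λ v~cj →
    <⇒≱ (s≤s (s≤s z≤n)) (shortest 1 (c j) (j , ≡.refl) (step tt (adj-sym v~cj) (here tt)))

  N3-sees-no-attached : ∀ {u} → Nbhd G 3 InC u → ∀ {m} → Attached m → u ≁ m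
  N3-sees-no-attached (_ , _ , shortest) (_ , i , m~ci) = ¬-not λ u~m →
    <⇒≱ (n<1+n 2) (shortest 2 (c i) (i , ≡.refl) (step tt (adj-sym m~ci) (step tt (adj-sym u~m) (here tt))))

  distant-nbr-of-attached⇒N2 : ∀ {m w} → Distant w → Attached m → m ~ w → Nbhd G 2 InC w
  distant-nbr-of-attached⇒N2 {w = w} (w∉C , w≁C) (_ , i , m~ci) m~w =
    w∉C , (c i , (i , ≡.refl) , step tt (adj-sym m~ci) (step tt m~w (here tt))) , shortest
    where
    shortest : ∀ j x → InC x → Walk G x w j → 2 ≤ j
    shortest zero _ x∈C (here _) = ⊥-elim (w∉C x∈C)
    shortest (suc zero) _ (i′ , ≡.refl) (step _ ci′~w (here _)) = ⊥-elim (~⇒¬≁ (adj-sym ci′~w) (w≁C i′))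
    shortest (suc (suc j)) _ _ _ = s≤s (s≤s z≤n)

module P5K23FreeLemmas (G : Graph) (c : Fin 5 → V G) (ic : IsInducedC5 G c)
  (noP5 : ¬ HasInduced 5 P5adj G) (noK23 : ¬ HasInduced 5 K23adj G) where

  open GraphLemmas G
  open InducedC5Lemmas G c ic

  attached-sees-opposite-pair : ∀ {y} → Attached y → ∃ λ j → y ~ c j × y ~ c (next (next j))
  attached-sees-opposite-pair {y} attached with attached-complete-or-switch attached
  ... | inj₁ complete = 0F , complete _ , complete _
  ... | inj₂ (i , y~i , y≁i+1) with adjacent-or-not y (c (next (next i)))
  ...   | inj₁ y~i+2 = i , y~i , y~i+2
  ...   | inj₂ y≁i+2 with adjacent-or-not y (c (next (next (next i))))
  ...     | inj₁ y~i+3 = next (next (next i)) , y~i+3 , ≡.subst (λ k → y ~ c k) (≡.sym (next⁵ i)) y~i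
  ...     | inj₂ y≁i+3 = ⊥-elim (noP5 (induced-P5 y~i (c-next i) (c-next _) (c-next _)
                            y≁i+1 y≁i+2 y≁i+3 (c-next² i) (c-next³ i) (c-next² (next i))))

  switch-spreads : ∀ {y i v t k} → y ~ c i → y ≁ c (next i) → WalkIn G Distant v t k → y ~ v → y ~ t
  switch-spreads _ _ (here _) y~v = y~v
  switch-spreads {y} {i} y~i y≁i+1 (step {w = w} v-far v~w rest) y~v with adjacent-or-not y w
  ... | inj₁ y~w = switch-spreads y~i y≁i+1 rest y~w
  ... | inj₂ y≁w = ⊥-elim (noP5 (induced-P5 (adj-sym v~w) (adj-sym y~v) y~i (c-next i)
                     (adj-sym y≁w) (proj₂ (walk-head rest) i) (proj₂ (walk-head rest) (next i))
                     (proj₂ v-far i) (proj₂ v-far (next i)) y≁i+1))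

  attached-complete-or-dominating : ∀ {y d} → Attached y → y ~ d →
    CompleteToC y ⊎ (∀ {t k} → WalkIn G Distant d t k → y ~ t)
  attached-complete-or-dominating attached y~d with attached-complete-or-switch attached
  ... | inj₁ complete = inj₁ complete
  ... | inj₂ (_ , y~i , y≁i+1) = inj₂ λ walk → switch-spreads y~i y≁i+1 walk y~d

  no-common-distant-nbr : ∀ {y y′ a} → CompleteToC y → Attached y′ → y ≁ y′ → y ≢ y′ →
    Distant a → y ~ a → y′ ~ a → ⊥
  no-common-distant-nbr complete attached′ y≁y′ y≢y′ a-far y~a y′~a with attached-sees-opposite-pair attached′
  ... | j , y′~j , y′~j+2 = noK23 (induced-K23 y~a (complete j) (complete _) y′~a y′~j y′~j+2
          y≁y′ (proj₂ a-far j) (proj₂ a-far _) (c-next² j)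
          y≢y′ (distant-≢ a-far j) (distant-≢ a-far _) (c-next²-≢ j))

  CompletePair : V G → V G → Set
  CompletePair y y′ = CompleteToC y × CompleteToC y′ × y ≁ y′ × y ≢ y′

  flip-pair : ∀ {y y′} → CompletePair y y′ → CompletePair y′ y
  flip-pair (complete , complete′ , y≁y′ , y≢y′) = complete′ , complete , adj-sym y≁y′ , ≢-sym y≢y′

  complete-pair-exclusive : ∀ {y y′ v} → CompletePair y y′ → Distant v → y ~ v → y′ ≁ v
  complete-pair-exclusive (complete , complete′ , y≁y′ , y≢y′) v-far y~v =
    ¬-not (no-common-distant-nbr complete (complete⇒attached complete′) y≁y′ y≢y′ v-far y~v)

  complete-pair-step : ∀ {y y′ v w} → CompletePair y y′ → Distant v → Distant w → v ~ w → y ~ v →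
    y ~ w ⊎ y′ ~ w
  complete-pair-step {y} {y′} {w = w} pair@(complete , complete′ , y≁y′ , _) v-far w-far v~w y~v
    with adjacent-or-not y w | adjacent-or-not y′ w
  ... | inj₁ y~w | _ = inj₁ y~w
  ... | inj₂ _ | inj₁ y′~w = inj₂ y′~w
  ... | inj₂ y≁w | inj₂ y′≁w = ⊥-elim (noP5 (induced-P5 (adj-sym v~w) (adj-sym y~v) (complete 0F)
          (adj-sym (complete′ 0F)) (adj-sym y≁w) (proj₂ w-far 0F) (adj-sym y′≁w) (proj₂ v-far 0F)
          (adj-sym (complete-pair-exclusive pair v-far y~v)) y≁y′))

  complete-pair-dominates : ∀ {y y′ v t k} → CompletePair y y′ → WalkIn G Distant v t k →
    y ~ v ⊎ y′ ~ v → y ~ t ⊎ y′ ~ t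
  complete-pair-dominates _ (here _) seen = seen
  complete-pair-dominates pair (step v-far v~w rest) (inj₁ y~v) =
    complete-pair-dominates pair rest (complete-pair-step pair v-far (walk-head rest) v~w y~v)
  complete-pair-dominates pair (step v-far v~w rest) (inj₂ y′~v) =
    complete-pair-dominates pair rest
      (swap (complete-pair-step (flip-pair pair) v-far (walk-head rest) v~w y′~v))

  module NoCliqueCutset (no-cut : ¬ HasCliqueCutSet G) where

    AttachedNbrsOf : VSet G → VSet G
    AttachedNbrsOf D y = Attached y × ∃ λ d → D d × d ~ y

    no-clique-separator : ∀ {D : VSet G} {u} → (∀ {x} → D x → Distant x) →
      (∀ {d w} → D d → d ~ w → ¬ Attached w → D w) → D u →
      ¬ (∀ {y y′} → AttachedNbrsOf D y → AttachedNbrsOf D y′ → y ≢ y′ → y ~ y′)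
    no-clique-separator {D} {u} D-far D-closed Du adjacent =
      no-cut (S , (λ _ _ Sy Sy′ y≢y′ → adjacent Sy Sy′ y≢y′) , u , c 0F , u∉S , c0∉S ,
              λ (_ , walk) → proj₁ (D-far (stays walk Du)) (0F , ≡.refl))
      where
      S : VSet G
      S = AttachedNbrsOf D

      stays : ∀ {v t k} → WalkIn G (Complement G S) v t k → D v → D t
      stays (here _) Dv = Dv
      stays (step _ v~w rest) Dv =
        stays rest (D-closed Dv v~w λ w-attached → walk-head rest (w-attached , _ , Dv , v~w))

      u∉S : ¬ S u
      u∉S ((_ , i , u~ci) , _) = ~⇒¬≁ u~ci (proj₂ (D-far Du) i)

      c0∉S : ¬ S (c 0F)
      c0∉S ((c0∉C , _) , _) = c0∉C (0F , ≡.refl)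

    isolated-distant-impossible : ∀ {u} → Distant u → ¬ (∀ {m} → Attached m → u ≁ m)
    isolated-distant-impossible {u} u-far u-blind =
      no-clique-separator component-member D-closed (0 , here u-far) adjacent
      where
      D : VSet G
      D = ComponentOf G Distant u

      D-closed : ∀ {d w} → D d → d ~ w → ¬ Attached w → D w
      D-closed Dd d~w ¬attached =
        component-extend Dd (not-attached⇒distant (distant-nbr-∉C (component-member Dd) d~w) ¬attached) d~w

      walk-to-u : ∀ {d} → D d → ∃ λ k → WalkIn G Distant d u k
      walk-to-u Dd = _ , walk-map component-member (proj₂ (component-walk Dd (0 , here u-far)))

      not-adjacent-to-u : ∀ {y} → AttachedNbrsOf D y → ¬ y ~ u
      not-adjacent-to-u (attached , _) y~u = ~⇒¬≁ (adj-sym y~u) (u-blind attached)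

      complete : ∀ {y} → AttachedNbrsOf D y → CompleteToC y
      complete Sy@(attached , d , Dd , d~y) with attached-complete-or-dominating attached (adj-sym d~y)
      ... | inj₁ complete-y = complete-y
      ... | inj₂ dominates = ⊥-elim (not-adjacent-to-u Sy (dominates (proj₂ (walk-to-u Dd))))

      adjacent : ∀ {y y′} → AttachedNbrsOf D y → AttachedNbrsOf D y′ → y ≢ y′ → y ~ y′
      adjacent Sy@(_ , d , Dd , d~y) Sy′ y≢y′ = adjacent-unless λ y≁y′ →
        [ not-adjacent-to-u Sy , not-adjacent-to-u Sy′ ]′
          (complete-pair-dominates (complete Sy , complete Sy′ , y≁y′ , y≢y′)
            (proj₂ (walk-to-u Dd)) (inj₁ (adj-sym d~y)))

    distant-sees-attached : ∀ {u} → Distant u → ∃ λ m → Attached m × u ~ m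
    distant-sees-attached {u} u-far with any? (λ m → attached? m ×-dec (adj G u m ≟ᵇ true))
    ... | yes found = found
    ... | no none =
      ⊥-elim (isolated-distant-impossible u-far λ {m} attached → ¬-not λ u~m → none (m , attached , u~m))

    N3-empty : ∀ u → ¬ Nbhd G 3 InC u
    N3-empty u u∈N3 = isolated-distant-impossible (far⇒distant u∈N3) (N3-sees-no-attached u∈N3)

    module N2Component (b : V G) where

      B : VSet G
      B = ComponentOf G (Nbhd G 2 InC) b

      B-far : ∀ {v} → B v → Distant v
      B-far Bv = far⇒distant (component-member Bv)

      B-far-walk : ∀ {v t} → B v → B t → ∃ λ k → WalkIn G Distant v t k
      B-far-walk Bv Bt = _ , walk-map B-far (proj₂ (component-walk Bv Bt))

      B-closed : ∀ {d w} → B d → d ~ w → ¬ Attached w → B w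
      B-closed {w = w} Bd d~w ¬attached = component-extend Bd (N2-by (distant-sees-attached w-far)) d~w
        where
        w-far : Distant w
        w-far = not-attached⇒distant (distant-nbr-∉C (B-far Bd) d~w) ¬attached

        N2-by : (∃ λ m → Attached m × w ~ m) → Nbhd G 2 InC w
        N2-by (_ , attached , w~m) = distant-nbr-of-attached⇒N2 w-far attached (adj-sym w~m)

      complete-or-dominates-B : ∀ {y a} → Attached y → B a → y ~ a → CompleteToC y ⊎ (∀ {v} → B v → y ~ v)
      complete-or-dominates-B attached Ba y~a with attached-complete-or-dominating attached y~a
      ... | inj₁ complete = inj₁ complete
      ... | inj₂ dominates = inj₂ λ Bv → dominates (proj₂ (B-far-walk Ba Bv))

      ω-attached-complete : SameCliqueNumber G B →
        Subset G (Inter G (N1 G B) (N1 G InC)) (NAll G c)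
      ω-attached-complete (k , ((L , clique , |L|≡k) , _) , (_ , maximal))
                          y ((y∉B , (x , Bx , step _ x~y (here _)) , _) , y∈N1C) =
        conclude (complete-or-dominates-B attached Bx (adj-sym x~y))
        where
        attached : Attached y
        attached = N1⇒attached y∈N1C

        conclude : CompleteToC y ⊎ (∀ {v} → B v → y ~ v) → NAll G c y
        conclude (inj₁ complete) = proj₁ attached , complete
        conclude (inj₂ dominates) = ⊥-elim (n≮n k (≡.subst (λ l → suc l ≤ k) |L|≡k (maximal (y ∷ L) larger)))
          where
          larger : CliqueList G (Everything G) (y ∷ L)
          larger = clique-cons clique tt (λ _ → tt)
                     λ {z} Bz → (λ y≡z → y∉B (≡.subst B (≡.sym y≡z) Bz)) , dominates Bz

      module CompletePairMeetingB {y y′} (pair : CompletePair y y′)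
        {a a′} (Ba : B a) (y~a : y ~ a) (Ba′ : B a′) (y′~a′ : y′ ~ a′) where

        complete : CompleteToC y
        complete = proj₁ pair

        complete′ : CompleteToC y′
        complete′ = proj₁ (proj₂ pair)

        cover : ∀ {v} → B v → y ~ v ⊎ y′ ~ v
        cover Bv = complete-pair-dominates pair (proj₂ (B-far-walk Ba Bv)) (inj₁ y~a)

        cross-walk : ∀ {v t k} → WalkIn G B v t k → y ~ v → y′ ~ t → ∃ λ x → B x × y′ ~ x × v ~ x
        cross-walk (here Bv) y~v y′~v = ⊥-elim (~⇒¬≁ y′~v (complete-pair-exclusive pair (B-far Bv) y~v))
        cross-walk {v} (step {w = w} Bv v~w rest) y~v y′~t with adjacent-or-not y′ w
        ... | inj₁ y′~w = w , walk-head rest , y′~w , v~w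
        ... | inj₂ y′≁w with complete-pair-step pair (B-far Bv) (B-far (walk-head rest)) v~w y~v
        ...   | inj₂ y′~w = ⊥-elim (~⇒¬≁ y′~w y′≁w)
        ...   | inj₁ y~w with cross-walk rest y~w y′~t
        ...     | x , Bx , y′~x , w~x with adjacent-or-not v x
        ...       | inj₁ v~x = x , Bx , y′~x , v~x
        ...       | inj₂ v≁x = ⊥-elim (noP5 (induced-P5 v~w w~x (adj-sym y′~x) (complete′ 0F)
                      v≁x (adj-sym (complete-pair-exclusive pair (B-far Bv) y~v)) (proj₂ (B-far Bv) 0F)
                      (adj-sym y′≁w) (proj₂ (B-far (walk-head rest)) 0F) (proj₂ (B-far Bx) 0F)))

        cross : ∀ {v} → B v → y ~ v → ∃ λ x → B x × y′ ~ x × v ~ x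
        cross Bv y~v = cross-walk (proj₂ (component-walk Bv Ba′)) y~v y′~a′

        no-two-nbrs-in-independent-triple : ∀ {p q r} → B p → B q → B r →
          Independent p q → Independent p r → Independent q r → y ~ p → y ~ q → ⊥
        no-two-nbrs-in-independent-triple {p} {q} {r} Bp Bq Br (p≢q , p≁q) (p≢r , p≁r) (q≢r , q≁r) y~p y~q
          with cross Bp y~p
        ... | x , Bx , y′~x , p~x = through-x (adjacent-or-not x q)
          where
          y≁y′ : y ≁ y′
          y≁y′ = proj₁ (proj₂ (proj₂ pair))

          y≁x : y ≁ x
          y≁x = complete-pair-exclusive (flip-pair pair) (B-far Bx) y′~x

          y′≁p : y′ ≁ p
          y′≁p = complete-pair-exclusive pair (B-far Bp) y~p

          long-path : ∀ {s} → B s → y ~ s → x ≁ s → p ≁ s → ⊥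
          long-path Bs y~s x≁s p≁s = noP5 (induced-P5 (adj-sym y~s) y~p p~x (adj-sym y′~x)
            (adj-sym p≁s) (adj-sym x≁s) (adj-sym (complete-pair-exclusive pair (B-far Bs) y~s))
            y≁x y≁y′ (adj-sym y′≁p))

          through-x : x ~ q ⊎ x ≁ q → ⊥
          through-x (inj₂ x≁q) = long-path Bq y~q x≁q p≁q
          through-x (inj₁ x~q) with adjacent-or-not y r | adjacent-or-not x r
          ... | inj₁ y~r | inj₁ x~r = noK23 (induced-K23 y~p y~q y~r (adj-sym p~x) x~q x~r y≁x p≁q p≁r q≁r
                                        (≢-sym (separated-by (proj₂ (B-far Bx) 0F) (complete 0F))) p≢q p≢r q≢r)
          ... | inj₁ y~r | inj₂ x≁r = long-path Br y~r x≁r p≁r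
          ... | inj₂ y≁r | x~r? with cover Br
          ...   | inj₁ y~r = ⊥-elim (~⇒¬≁ y~r y≁r)
          ...   | inj₂ y′~r with x~r?
          ...     | inj₁ x~r = noP5 (induced-P5 (adj-sym x~r) (adj-sym p~x) (adj-sym y~p) (complete 0F)
                                 (adj-sym p≁r) (adj-sym y≁r) (proj₂ (B-far Br) 0F)
                                 (adj-sym y≁x) (proj₂ (B-far Bx) 0F) (proj₂ (B-far Bp) 0F))
          ...     | inj₂ x≁r = noP5 (induced-P5 (adj-sym y′~r) y′~x (adj-sym p~x) (adj-sym y~p)
                                 (adj-sym x≁r) (adj-sym p≁r) (adj-sym y≁r)
                                 y′≁p (adj-sym y≁y′) (adj-sym y≁x))

      complete-pair-no-independent-triple : ∀ {y y′ a a′ p q r} → CompletePair y y′ →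
        B a → y ~ a → B a′ → y′ ~ a′ → B p → B q → B r →
        Independent p q → Independent p r → Independent q r → ⊥
      complete-pair-no-independent-triple {y} {y′} {p = p} {q} {r} pair Ba y~a Ba′ y′~a′ Bp Bq Br pq pr qr =
        pigeonhole (Y.cover Bp) (Y.cover Bq) (Y.cover Br)
        where
        module Y = CompletePairMeetingB pair Ba y~a Ba′ y′~a′
        module Y′ = CompletePairMeetingB (flip-pair pair) Ba′ y′~a′ Ba y~a

        pigeonhole : y ~ p ⊎ y′ ~ p → y ~ q ⊎ y′ ~ q → y ~ r ⊎ y′ ~ r → ⊥
        pigeonhole (inj₁ y~p) (inj₁ y~q) _ =
          Y.no-two-nbrs-in-independent-triple Bp Bq Br pq pr qr y~p y~q
        pigeonhole (inj₁ y~p) _ (inj₁ y~r) =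
          Y.no-two-nbrs-in-independent-triple Bp Br Bq pr pq (independent-sym qr) y~p y~r
        pigeonhole _ (inj₁ y~q) (inj₁ y~r) =
          Y.no-two-nbrs-in-independent-triple Bq Br Bp qr (independent-sym pq) (independent-sym pr) y~q y~r
        pigeonhole (inj₂ y′~p) (inj₂ y′~q) _ =
          Y′.no-two-nbrs-in-independent-triple Bp Bq Br pq pr qr y′~p y′~q
        pigeonhole (inj₂ y′~p) _ (inj₂ y′~r) =
          Y′.no-two-nbrs-in-independent-triple Bp Br Bq pr pq (independent-sym qr) y′~p y′~r
        pigeonhole _ (inj₂ y′~q) (inj₂ y′~r) =
          Y′.no-two-nbrs-in-independent-triple Bq Br Bp qr (independent-sym pq) (independent-sym pr) y′~q y′~r

      no-independent-triple : ∀ {p q r} → B p → B q → B r →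
        Independent p q → Independent p r → Independent q r → ⊥
      no-independent-triple Bp Bq Br pq@(p≢q , p≁q) pr@(p≢r , p≁r) qr@(q≢r , q≁r) =
        no-clique-separator B-far B-closed Bp adjacent
        where
        S : VSet G
        S = AttachedNbrsOf B

        side : ∀ {y} → S y → CompleteToC y ⊎ (∀ {v} → B v → y ~ v)
        side (attached , _ , Ba , a~y) = complete-or-dominates-B attached Ba (adj-sym a~y)

        nonadjacent : ∀ {y y′} → S y → S y′ → y ≁ y′ → y ≢ y′ →
          CompleteToC y ⊎ (∀ {v} → B v → y ~ v) → CompleteToC y′ ⊎ (∀ {v} → B v → y′ ~ v) → ⊥
        nonadjacent _ _ y≁y′ y≢y′ (inj₂ dominates) (inj₂ dominates′) =
          noK23 (induced-K23 (dominates Bp) (dominates Bq) (dominates Br)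
                  (dominates′ Bp) (dominates′ Bq) (dominates′ Br)
                  y≁y′ p≁q p≁r q≁r y≢y′ p≢q p≢r q≢r)
        nonadjacent (_ , _ , Ba , a~y) (attached′ , _) y≁y′ y≢y′ (inj₁ complete) (inj₂ dominates′) =
          no-common-distant-nbr complete attached′ y≁y′ y≢y′ (B-far Ba) (adj-sym a~y) (dominates′ Ba)
        nonadjacent (attached , _) (_ , _ , Ba′ , a′~y′) y≁y′ y≢y′ (inj₂ dominates) (inj₁ complete′) =
          no-common-distant-nbr complete′ attached (adj-sym y≁y′) (≢-sym y≢y′)
            (B-far Ba′) (adj-sym a′~y′) (dominates Ba′)
        nonadjacent (_ , _ , Ba , a~y) (_ , _ , Ba′ , a′~y′) y≁y′ y≢y′ (inj₁ complete) (inj₁ complete′) =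
          complete-pair-no-independent-triple (complete , complete′ , y≁y′ , y≢y′)
            Ba (adj-sym a~y) Ba′ (adj-sym a′~y′) Bp Bq Br pq pr qr

        adjacent : ∀ {y y′} → S y → S y′ → y ≢ y′ → y ~ y′
        adjacent Sy Sy′ y≢y′ = adjacent-unless λ y≁y′ → nonadjacent Sy Sy′ y≁y′ y≢y′ (side Sy) (side Sy′)

      α-bound : AlphaLe G B 2
      α-bound [] _ = z≤n
      α-bound (_ ∷ []) _ = s≤s z≤n
      α-bound (_ ∷ _ ∷ []) _ = s≤s (s≤s z≤n)
      α-bound (_ ∷ _ ∷ _ ∷ _) ((Bp ∷ Bq ∷ Br ∷ _) , ((pq ∷ pr ∷ _) ∷ (qr ∷ _) ∷ _)) =
        ⊥-elim (no-independent-triple Bp Bq Br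
                  (¬adjacent⇒independent pq) (¬adjacent⇒independent pr) (¬adjacent⇒independent qr))

lemma4p2 : (G : Graph) → Connected G →
    ¬ HasInduced 5 P5adj G → ¬ HasInduced 5 K23adj G →
    (c : Fin 5 → V G) → IsInducedC5 G c →
    ¬ HasCliqueCutSet G →
      (∀ u → ¬ Nbhd G 3 (VertexSetOf G c) u)
      × (∀ b → Nbhd G 2 (VertexSetOf G c) b →
           AlphaLe G (ComponentOf G (Nbhd G 2 (VertexSetOf G c)) b) 2
           × (SameCliqueNumber G (ComponentOf G (Nbhd G 2 (VertexSetOf G c)) b) →
              Subset G
                (Inter G (N1 G (ComponentOf G (Nbhd G 2 (VertexSetOf G c)) b))
                         (N1 G (VertexSetOf G c)))
                (NAll G c)))
lemma4p2 G _ noP5 noK23 c ic no-cut =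
  N3-empty , λ b _ → N2Component.α-bound b , N2Component.ω-attached-complete b
  where open P5K23FreeLemmas.NoCliqueCutset G c ic noP5 noK23 no-cut
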